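{- Let $F,G:\mathbb{Z}^2\to\mathbb{Z}$ be superharmonic functions such that $H=F-G$ is non-negative and bounded, and let $m$ be the maximal value of $H$. Let $H_m=\chi(H\ge m)$ be the function equal to $1$ where $H\ge m$ and $0$ elsewhere. Then $F-H_m$ is superharmonic.
   Context: The discrete Laplacian is $\Delta F(x,y)=-4F(x,y)+F(x+1,y)+F(x-1,y)+F(x,y+1)+F(x,y-1)$. The function $F$ is superharmonic if $\Delta F\le0$ everywhere. -}

module Defs where

open import Data.Integer using (ℤ; _+_; _-_; _*_; _≤_; +_; 0ℤ; 1ℤ; _≤?_)
open import Relation.Nullary using (yes; no)

Fun : Set
Fun = ℤ → ℤ → ℤ

Δ : Fun → Fun
Δ F x y = ((((- (+ 4)) * F x y + F (x + 1ℤ) y) + F (x - 1ℤ) y) + F x (y + 1ℤ)) + F x (y - 1ℤ)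
  where open import Data.Integer using (-_)

Superharmonic : Fun → Set
Superharmonic F = ∀ x y → Δ F x y ≤ 0ℤ

_⊖_ : Fun → Fun → Fun
(F ⊖ G) x y = F x y - G x y

χ≥ : Fun → ℤ → Fun
χ≥ H m x y with m ≤? H x y
... | yes _ = 1ℤ
... | no  _ = 0ℤ

module Submission where

-- Write H = F - G and C = χ(H ≥ m).  The Laplacian is linear and,
-- at a point p, equals the sum of the four differences K(q) - K(p) over the
-- neighbours q of p; hence Δ K (p) ≤ 0 at a local maximum of K and
-- Δ K (p) ≥ 0 at a local minimum.  Fix p.
--   * If H(p) < m, then C(p) = 0 is a minimum of C ≥ 0, so
--     Δ(F - C)(p) = ΔF(p) - ΔC(p) ≤ ΔF(p) ≤ 0.
--   * If H(p) ≥ m, then H - C ≤ m - 1 everywhere (as H ≤ m) while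
--     (H - C)(p) = H(p) - 1 ≥ m - 1, so p is a maximum of H - C and
--     Δ(F - C)(p) = ΔG(p) + Δ(H - C)(p) ≤ 0.
-- The file first proves the facts about Δ (linearity, sign at local
-- extrema), then the facts about the indicator χ≥ and the function H - C,
-- and finally combines them.

open import Defs
open import Data.Nat using (z≤n)
open import Data.Integer using (ℤ; +_; +≤+; _≤_; 0ℤ; 1ℤ; _<_; _+_; _-_; _*_; -_; _≤?_)
open import Data.Integer.Properties
  using (+-mono-≤; +-monoˡ-≤; neg-mono-≤; i≤j⇒i-j≤0; i≤j⇒0≤j-i;
         ≰⇒>; ≤⇒≯; i<j⇒i≤pred[j]; +-comm; +-identityʳ; ≤-refl; ≤-trans)
open import Data.Integer.Tactic.RingSolver using (solve-∀)
open import Data.Product using (∃; ∃₂; _×_; _,_)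
open import Relation.Nullary using (Dec; yes; no; contradiction)
open import Relation.Binary.PropositionalEquality using (_≡_; refl; sym; cong; subst; subst₂; module ≡-Reasoning)

AtNeighbours : (ℤ → ℤ → Set) → ℤ → ℤ → Set
AtNeighbours P x y = P (x + 1ℤ) y × P (x - 1ℤ) y × P x (y + 1ℤ) × P x (y - 1ℤ)

everywhere⇒atNeighbours : ∀ {P : ℤ → ℤ → Set} → (∀ a b → P a b) →
  ∀ x y → AtNeighbours P x y
everywhere⇒atNeighbours p x y = p _ _ , p _ _ , p _ _ , p _ _

Δ-asDifferences : ∀ K x y → Δ K x y ≡
  (((K (x + 1ℤ) y - K x y) + (K (x - 1ℤ) y - K x y))
    + (K x (y + 1ℤ) - K x y)) + (K x (y - 1ℤ) - K x y)
Δ-asDifferences K x y =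
  identity (K x y) (K (x + 1ℤ) y) (K (x - 1ℤ) y) (K x (y + 1ℤ)) (K x (y - 1ℤ))
  where
  identity : ∀ k₀ k₁ k₂ k₃ k₄ →
    ((((- (+ 4)) * k₀ + k₁) + k₂) + k₃) + k₄
    ≡ (((k₁ - k₀) + (k₂ - k₀)) + (k₃ - k₀)) + (k₄ - k₀)
  identity = solve-∀

Δ-⊖ : ∀ A B x y → Δ (A ⊖ B) x y ≡ Δ A x y - Δ B x y
Δ-⊖ A B x y =
  identity (A x y) (A (x + 1ℤ) y) (A (x - 1ℤ) y) (A x (y + 1ℤ)) (A x (y - 1ℤ))
           (B x y) (B (x + 1ℤ) y) (B (x - 1ℤ) y) (B x (y + 1ℤ)) (B x (y - 1ℤ))
  where
  identity : ∀ a₀ a₁ a₂ a₃ a₄ b₀ b₁ b₂ b₃ b₄ →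
    ((((- (+ 4)) * (a₀ - b₀) + (a₁ - b₁)) + (a₂ - b₂)) + (a₃ - b₃)) + (a₄ - b₄)
    ≡ (((((- (+ 4)) * a₀ + a₁) + a₂) + a₃) + a₄)
      - (((((- (+ 4)) * b₀ + b₁) + b₂) + b₃) + b₄)
  identity = solve-∀

Δ-split : ∀ F G C x y → Δ (F ⊖ C) x y ≡ Δ G x y + Δ ((F ⊖ G) ⊖ C) x y
Δ-split F G C x y = begin
  Δ (F ⊖ C) x y                            ≡⟨ Δ-⊖ F C x y ⟩
  Δ F x y - Δ C x y                        ≡⟨ identity (Δ F x y) (Δ G x y) (Δ C x y) ⟩
  Δ G x y + ((Δ F x y - Δ G x y) - Δ C x y) ≡⟨ cong (λ h → Δ G x y + (h - Δ C x y)) (sym (Δ-⊖ F G x y)) ⟩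
  Δ G x y + (Δ (F ⊖ G) x y - Δ C x y)       ≡⟨ cong (λ h → Δ G x y + h) (sym (Δ-⊖ (F ⊖ G) C x y)) ⟩
  Δ G x y + Δ ((F ⊖ G) ⊖ C) x y             ∎
  where
  open ≡-Reasoning
  identity : ∀ f g c → f - c ≡ g + ((f - g) - c)
  identity = solve-∀

Δ-atLocalMax : ∀ K x y → AtNeighbours (λ a b → K a b ≤ K x y) x y →
  Δ K x y ≤ 0ℤ
Δ-atLocalMax K x y (le₁ , le₂ , le₃ , le₄) rewrite Δ-asDifferences K x y =
  +-mono-≤ (+-mono-≤ (+-mono-≤ (i≤j⇒i-j≤0 le₁) (i≤j⇒i-j≤0 le₂))
                      (i≤j⇒i-j≤0 le₃))
           (i≤j⇒i-j≤0 le₄)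

Δ-atLocalMin : ∀ K x y → AtNeighbours (λ a b → K x y ≤ K a b) x y →
  0ℤ ≤ Δ K x y
Δ-atLocalMin K x y (le₁ , le₂ , le₃ , le₄) rewrite Δ-asDifferences K x y =
  +-mono-≤ (+-mono-≤ (+-mono-≤ (i≤j⇒0≤j-i le₁) (i≤j⇒0≤j-i le₂))
                      (i≤j⇒0≤j-i le₃))
           (i≤j⇒0≤j-i le₄)

χ≥-below : ∀ H m x y → H x y < m → χ≥ H m x y ≡ 0ℤ
χ≥-below H m x y H<m with m ≤? H x y
... | yes m≤H = contradiction H<m (≤⇒≯ m≤H)
... | no  _   = refl

χ≥-nonneg : ∀ H m x y → 0ℤ ≤ χ≥ H m x y
χ≥-nonneg H m x y with m ≤? H x y
... | yes _ = +≤+ z≤n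
... | no  _ = ≤-refl

dropTop-bounded : ∀ H m → (∀ a b → H a b ≤ m) →
  ∀ a b → (H ⊖ χ≥ H m) a b ≤ m - 1ℤ
dropTop-bounded H m H≤m a b with m ≤? H a b
... | yes _   = +-monoˡ-≤ (- 1ℤ) (H≤m a b)
... | no  m≰H = subst₂ _≤_ (sym (+-identityʳ (H a b))) (+-comm (- 1ℤ) m)
                       (i<j⇒i≤pred[j] (≰⇒> m≰H))

dropTop-maximal : ∀ H m → (∀ a b → H a b ≤ m) → ∀ x y → m ≤ H x y →
  ∀ a b → (H ⊖ χ≥ H m) a b ≤ (H ⊖ χ≥ H m) x y
dropTop-maximal H m H≤m x y m≤H a b with m ≤? H x y
... | yes _   = ≤-trans (dropTop-bounded H m H≤m a b) (+-monoˡ-≤ (- 1ℤ) m≤H)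
... | no  m≰H = contradiction m≤H m≰H

lemma4p1 : (F G : Fun) → Superharmonic F → Superharmonic G →
    (∀ x y → 0ℤ ≤ (F ⊖ G) x y) →
    (∃ λ B → ∀ x y → (F ⊖ G) x y ≤ B) →
    (m : ℤ) → (∀ x y → (F ⊖ G) x y ≤ m) → (∃₂ λ x y → (F ⊖ G) x y ≡ m) →
    Superharmonic (F ⊖ χ≥ (F ⊖ G) m)
lemma4p1 F G superF superG _ _ m H≤m _ x y = byLevel (m ≤? H x y)
  where
  H = F ⊖ G
  C = χ≥ H m

  byLevel : Dec (m ≤ H x y) → Δ (F ⊖ C) x y ≤ 0ℤ
  -- On the top level set, F - C = G + (H - C) and H - C is maximal here.
  byLevel (yes m≤H) =
    subst (_≤ 0ℤ) (sym (Δ-split F G C x y))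
      (+-mono-≤ (superG x y)
        (Δ-atLocalMax (H ⊖ C) x y
          (everywhere⇒atNeighbours (dropTop-maximal H m H≤m x y m≤H) x y)))
  -- Below it, C vanishes here, so C ≥ 0 is minimal here and ΔC ≥ 0.
  byLevel (no m≰H) =
    subst (_≤ 0ℤ) (sym (Δ-⊖ F C x y))
      (+-mono-≤ (superF x y)
        (neg-mono-≤ (Δ-atLocalMin C x y (everywhere⇒atNeighbours Cₓ≤C x y))))
    where
    Cₓ≤C : ∀ a b → C x y ≤ C a b
    Cₓ≤C a b rewrite χ≥-below H m x y (≰⇒> m≰H) = χ≥-nonneg H m a b
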